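{- In CCL, for all CCL-formulas $F,G,H$, the formulas $((F\vec{\odot}G)\vec{\odot}H)$ and $(F\vec{\odot}(G\vec{\odot}H))$ are strongly equivalent.
   Context: Let $\mathcal{U}$ be an infinite set of propositional variables; an interpretation is a set $\mathcal{I}\subseteq\mathcal{U}$. Write $\overline{\mathbb{N}}=\mathbb{N}\cup\{\infty\}$. CCL-formulas are built from variables with $\neg,\wedge,\vee$ and the binary connective $\vec{\odot}$. Optionality and degree: $\mathrm{opt}(a)=\mathrm{opt}(\neg F)=1$, $\mathrm{opt}(F\wedge G)=\mathrm{opt}(F\vee G)=\max(\mathrm{opt}(F),\mathrm{opt}(G))$; $\deg(\mathcal{I},a)=1$ if $a\in\mathcal{I}$ else $\infty$; $\deg(\mathcal{I},\neg F)=1$ if $\deg(\mathcal{I},F)=\infty$ else $\infty$; $\deg(\mathcal{I},F\wedge G)=\max$, $\deg(\mathcal{I},F\vee G)=\min$ of the operand degrees. With $k=\mathrm{opt}(F)$, $\ell=\mathrm{opt}(G)$, $m=\deg(\mathcal{I},F)$, $n=\deg(\mathcal{I},G)$: $\mathrm{opt}(F\vec{\odot}G)=k+\ell$ and $\deg(\mathcal{I},F\vec{\odot}G)=n$ if $m=1$ and $n<\infty$; $m+\ell$ if $m<\infty$ and ($m>1$ or $n=\infty$); $\infty$ otherwise. $\mathcal{I}\in\mathrm{Pref}(F)$ iff $\deg(\mathcal{I},F)\ne\infty$ and $\deg(\mathcal{I},F)\le\deg(\mathcal{J},F)$ for all $\mathcal{J}$. $F[A/B]$: substitute an occurrence of $A$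 in $F$ by $B$. $A,B$ are strongly equivalent if $\mathrm{Pref}(F)=\mathrm{Pref}(F[A/B])$ for all CCL-formulas $F$. -}

module Defs where

open import Data.Nat using (ℕ; _+_; _⊔_; _≤_)
open import Data.Bool using (Bool; true; false)
open import Data.Product using (_×_)
open import Function.Bundles using (_⇔_)
open import Relation.Binary.PropositionalEquality using (_≡_)
open import Relation.Nullary using (¬_)

Var : Set
Var = ℕ

-- Interpretations: arbitrary subsets of 𝒰, given by characteristic functions.
Interp : Set
Interp = Var → Bool

infixr 5 _⊙_
data Formula : Set where
  var  : Var → Formula
  ¬'   : Formula → Formula
  _∧'_ : Formula → Formula → Formula
  _∨'_ : Formula → Formula → Formula
  _⊙_  : Formula → Formula → Formula

data ℕ∞ : Set where
  fin : ℕ → ℕ∞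
  ∞   : ℕ∞

max∞ : ℕ∞ → ℕ∞ → ℕ∞
max∞ (fin m) (fin n) = fin (m ⊔ n)
max∞ _ _ = ∞

min∞ : ℕ∞ → ℕ∞ → ℕ∞
min∞ (fin m) (fin n) = fin (Data.Nat._⊓_ m n)
min∞ (fin m) ∞ = fin m
min∞ ∞ n = n

_≤∞_ : ℕ∞ → ℕ∞ → Set
fin m ≤∞ fin n = m ≤ n
fin m ≤∞ ∞ = Data.Unit.⊤ where import Data.Unit
∞ ≤∞ fin n = Data.Empty.⊥ where import Data.Empty
∞ ≤∞ ∞ = Data.Unit.⊤ where import Data.Unit

opt : Formula → ℕ
opt (var a) = 1
opt (¬' F) = 1
opt (F ∧' G) = opt F ⊔ opt G
opt (F ∨' G) = opt F ⊔ opt G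
opt (F ⊙ G) = opt F + opt G

deg⊙ : ℕ∞ → ℕ∞ → ℕ → ℕ∞
deg⊙ (fin 1) (fin n) ℓ = fin n
deg⊙ (fin m) n ℓ = fin (m + ℓ)   -- here m > 1 or n = ∞
deg⊙ ∞ n ℓ = ∞

deg : Interp → Formula → ℕ∞
deg I (var a) with I a
... | true  = fin 1
... | false = ∞
deg I (¬' F) with deg I F
... | ∞     = fin 1
... | fin _ = ∞
deg I (F ∧' G) = max∞ (deg I F) (deg I G)
deg I (F ∨' G) = min∞ (deg I F) (deg I G)
deg I (F ⊙ G) = deg⊙ (deg I F) (deg I G) (opt G)

Pref : Formula → Interp → Set
Pref F I = (¬ (deg I F ≡ ∞)) × (∀ (J : Interp) → deg I F ≤∞ deg J F)

data Ctx : Set where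
  hole : Ctx
  ¬c   : Ctx → Ctx
  ∧l   : Ctx → Formula → Ctx
  ∧r   : Formula → Ctx → Ctx
  ∨l   : Ctx → Formula → Ctx
  ∨r   : Formula → Ctx → Ctx
  ⊙l   : Ctx → Formula → Ctx
  ⊙r   : Formula → Ctx → Ctx

plug : Ctx → Formula → Formula
plug hole A = A
plug (¬c C) A = ¬' (plug C A)
plug (∧l C G) A = plug C A ∧' G
plug (∧r F C) A = F ∧' plug C A
plug (∨l C G) A = plug C A ∨' G
plug (∨r F C) A = F ∨' plug C A
plug (⊙l C G) A = plug C A ⊙ G
plug (⊙r F C) A = F ⊙ plug C A

-- A and B strongly equivalent: replacing an occurrence of A by B in any
-- formula preserves the set of preferred models.  Formulas F[A/B] are exactly
-- plug C B where F = plug C A.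
StronglyEquivalent : Formula → Formula → Set
StronglyEquivalent A B = ∀ (C : Ctx) (I : Interp) → Pref (plug C A) I ⇔ Pref (plug C B) I

-- Degrees are never 0 and optionalities are at least 1; under these two facts
-- the degree function of ⊙⃗ is associative, with the optionality of the inner
-- operand added in.  Since degree and optionality of a formula are computed
-- compositionally from those of its subformulas, two formulas with the same
-- optionality and the same degree in every interpretation can be exchanged
-- inside any context without changing the degree, hence the preferred models.
module Submission where

open import Defs
open import Data.Nat using (suc; _+_; _⊔_; _≤_; s≤s; z≤n)
open import Data.Nat.Properties using (+-assoc; m≤n⇒m≤n⊔o)
open import Data.Unit using (⊤; tt)
open import Data.Bool using (true; false)
open import Data.Product using (_,_)
open import Function.Bundles using (mk⇔)
open import Relation.Binary.PropositionalEquality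
  using (_≡_; refl; sym; trans; cong; cong₂; subst₂)

Positive∞ : ℕ∞ → Set
Positive∞ (fin n) = 1 ≤ n
Positive∞ ∞       = ⊤

opt-positive : ∀ F → 1 ≤ opt F
opt-positive (var _)  = s≤s z≤n
opt-positive (¬' _)   = s≤s z≤n
opt-positive (F ∧' G) = m≤n⇒m≤n⊔o (opt G) (opt-positive F)
opt-positive (F ∨' G) = m≤n⇒m≤n⊔o (opt G) (opt-positive F)
opt-positive (F ⊙ G) with opt F | opt-positive F
... | suc _ | _ = s≤s z≤n

max∞-positive : ∀ m n → Positive∞ m → Positive∞ n → Positive∞ (max∞ m n)
max∞-positive (fin m) (fin n) p _ = m≤n⇒m≤n⊔o n p
max∞-positive (fin _) ∞       _ _ = tt
max∞-positive ∞       _       _ _ = tt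

min∞-positive : ∀ m n → Positive∞ m → Positive∞ n → Positive∞ (min∞ m n)
min∞-positive (fin (suc _)) (fin (suc _)) _ _ = s≤s z≤n
min∞-positive (fin _)       ∞             p _ = p
min∞-positive ∞             _             _ q = q

deg⊙-positive : ∀ m n ℓ → Positive∞ m → Positive∞ n → Positive∞ (deg⊙ m n ℓ)
deg⊙-positive (fin 1)             (fin _) _ _ q = q
deg⊙-positive (fin 1)             ∞       _ _ _ = s≤s z≤n
deg⊙-positive (fin (suc (suc _))) _       _ _ _ = s≤s z≤n
deg⊙-positive ∞                   _       _ _ _ = tt

deg-positive : ∀ I F → Positive∞ (deg I F)
deg-positive I (var a) with I a
... | true  = s≤s z≤n
... | false = tt
deg-positive I (¬' F) with deg I F
... | ∞     = s≤s z≤n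
... | fin _ = tt
deg-positive I (F ∧' G) = max∞-positive (deg I F) (deg I G) (deg-positive I F) (deg-positive I G)
deg-positive I (F ∨' G) = min∞-positive (deg I F) (deg I G) (deg-positive I F) (deg-positive I G)
deg-positive I (F ⊙ G)  = deg⊙-positive (deg I F) (deg I G) (opt G) (deg-positive I F) (deg-positive I G)

-- Without the positivity hypotheses the cases m = 0, and m = 1 with
-- n = ∞ and ℓ = 0, would fall into the clause deg⊙ (fin 1) on one side only.
deg⊙-assoc : ∀ m n p ℓ r → Positive∞ m → 1 ≤ ℓ →
             deg⊙ (deg⊙ m n ℓ) p r ≡ deg⊙ m (deg⊙ n p r) (ℓ + r)
deg⊙-assoc (fin 1)             (fin 0)             _       _       _ _ _ = refl
deg⊙-assoc (fin 1)             (fin 1)             (fin _) _       _ _ _ = refl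
deg⊙-assoc (fin 1)             (fin 1)             ∞       _       _ _ _ = refl
deg⊙-assoc (fin 1)             (fin (suc (suc _))) _       _       _ _ _ = refl
deg⊙-assoc (fin 1)             ∞                   _       (suc _) _ _ _ = refl
deg⊙-assoc (fin (suc (suc k))) _                   _       ℓ       r _ _ =
  cong fin (+-assoc (suc (suc k)) ℓ r)
deg⊙-assoc ∞                   _                   _       _       _ _ _ = refl

record _≋_ (A B : Formula) : Set where
  constructor _,_
  field
    opt-≡ : opt A ≡ opt B
    deg-≡ : ∀ I → deg I A ≡ deg I B

⊙-assoc-≋ : ∀ F G H → ((F ⊙ G) ⊙ H) ≋ (F ⊙ (G ⊙ H))
⊙-assoc-≋ F G H =
  +-assoc (opt F) (opt G) (opt H) ,
  λ I → deg⊙-assoc (deg I F) (deg I G) (deg I H) (opt G) (opt H)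
                   (deg-positive I F) (opt-positive G)

deg-¬-cong : ∀ I F G → deg I F ≡ deg I G → deg I (¬' F) ≡ deg I (¬' G)
deg-¬-cong I F G e with deg I F | deg I G
deg-¬-cong I F G refl | fin _ | _ = refl
deg-¬-cong I F G refl | ∞     | _ = refl

plug-≋ : ∀ C {A B} → A ≋ B → plug C A ≋ plug C B
plug-≋ hole e = e
plug-≋ (¬c C) {A} {B} e =
  refl , λ I → deg-¬-cong I (plug C A) (plug C B) (_≋_.deg-≡ (plug-≋ C e) I)
plug-≋ (∧l C G) e with plug-≋ C e
... | o , d = cong (_⊔ opt G) o , λ I → cong (λ x → max∞ x (deg I G)) (d I)
plug-≋ (∧r F C) e with plug-≋ C e
... | o , d = cong (opt F ⊔_) o , λ I → cong (max∞ (deg I F)) (d I)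
plug-≋ (∨l C G) e with plug-≋ C e
... | o , d = cong (_⊔ opt G) o , λ I → cong (λ x → min∞ x (deg I G)) (d I)
plug-≋ (∨r F C) e with plug-≋ C e
... | o , d = cong (opt F ⊔_) o , λ I → cong (min∞ (deg I F)) (d I)
plug-≋ (⊙l C G) e with plug-≋ C e
... | o , d = cong (_+ opt G) o , λ I → cong (λ x → deg⊙ x (deg I G) (opt G)) (d I)
plug-≋ (⊙r F C) e with plug-≋ C e
... | o , d = cong (opt F +_) o , λ I → cong₂ (deg⊙ (deg I F)) (d I) o

Pref-resp-deg : ∀ A B → (∀ J → deg J A ≡ deg J B) → ∀ I → Pref A I → Pref B I
Pref-resp-deg A B d I (defined , minimal) =
  (λ ∞≡ → defined (trans (d I) ∞≡)) , λ J → subst₂ _≤∞_ (d I) (d J) (minimal J)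

≋⇒StronglyEquivalent : ∀ {A B} → A ≋ B → StronglyEquivalent A B
≋⇒StronglyEquivalent {A} {B} e C I with plug-≋ C e
... | _ , d = mk⇔ (Pref-resp-deg (plug C A) (plug C B) d I)
                  (Pref-resp-deg (plug C B) (plug C A) (λ J → sym (d J)) I)

lemma6 : ∀ (F G H : Formula) → StronglyEquivalent ((F ⊙ G) ⊙ H) (F ⊙ (G ⊙ H))
lemma6 F G H = ≋⇒StronglyEquivalent (⊙-assoc-≋ F G H)
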